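{- Let $q$ be an odd prime power and let $S\subseteq M_2(\mathbb F_q)$ be of product type. Then for each $i\in\mathbb F_q^*$, $$\left||S\cap D_i|-\frac{|S|}{q}\right|\le q^{1/2}|S|^{1/2}.$$
   Context: $M_2(\mathbb F_q)$ is the set of $2\times 2$ matrices over the finite field $\mathbb F_q$. A set $S\subseteq M_2(\mathbb F_q)$ is of product type if there are $S_1,S_2\subseteq\mathbb F_q^2$ such that $S$ is the set of matrices whose first row lies in $S_1$ and whose second row lies in $S_2$. $D_i=\{x\in M_2(\mathbb F_q):\det(x)=i\}$. -}

module Defs where

open import Level using (0ℓ)
open import Data.Nat as ℕ using (ℕ; suc)
open import Data.Nat.Primality using (Prime)
open import Data.Fin using (Fin)
import Data.Fin.Properties as FinP
open import Data.Bool using (Bool; _∧_)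
import Data.Bool
open import Data.List using (List; length; filter; map; allFin; concatMap)
open import Data.Product using (Σ; ∃; _×_; _,_; proj₁; proj₂)
open import Function.Bundles using (_↔_; Inverse)
open import Algebra.Structures using (IsCommutativeRing)
open import Relation.Binary.PropositionalEquality using (_≡_; _≢_; cong; sym; trans)
open import Relation.Nullary using (Dec; yes; no; does)
open import Relation.Nullary.Decidable using (map′)

record FiniteField : Set₁ where
  infixl 7 _*_
  infixl 6 _+_ _-_
  field
    Carrier : Set
    _+_ _*_ : Carrier → Carrier → Carrier
    -_ : Carrier → Carrier
    0# 1# : Carrier
    isCommutativeRing : IsCommutativeRing _≡_ _+_ _*_ -_ 0# 1#
    0≢1 : 0# ≢ 1#
    inverse : ∀ x → x ≢ 0# → ∃ λ y → x * y ≡ 1#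
    order : ℕ
    enum : Carrier ↔ Fin order

  _-_ : Carrier → Carrier → Carrier
  x - y = x + (- y)

  open Inverse enum using (to; from; inverseʳ; to-cong)

  _≟_ : (x y : Carrier) → Dec (x ≡ y)
  x ≟ y = map′ (λ e → trans (sym (inverseʳ _≡_.refl)) (trans (cong from e) (inverseʳ _≡_.refl)))
               (cong to) (to x FinP.≟ to y)

  elements : List Carrier
  elements = map from (allFin order)

IsPrimePower : ℕ → Set
IsPrimePower q = Σ ℕ λ p → Σ ℕ λ k → Prime p × q ≡ p ℕ.^ suc k

IsOdd : ℕ → Set
IsOdd q = Σ ℕ λ m → q ≡ suc (2 ℕ.* m)

module Matrices (F : FiniteField) where
  open FiniteField F

  Vec2 : Set
  Vec2 = Carrier × Carrier

  -- a 2×2 matrix, stored as (first row , second row)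
  M2 : Set
  M2 = Vec2 × Vec2

  row₁ row₂ : M2 → Vec2
  row₁ = proj₁
  row₂ = proj₂

  det : M2 → Carrier
  det ((a , b) , (c , d)) = a * d - b * c

  vecs : List Vec2
  vecs = concatMap (λ a → map (λ b → (a , b)) elements) elements

  matrices : List M2
  matrices = concatMap (λ r → map (λ s → (r , s)) vecs) vecs

  Subset : Set
  Subset = M2 → Bool

  ∣_∣ : Subset → ℕ
  ∣ S ∣ = length (filter (λ x → Data.Bool._≟_ (S x) Data.Bool.true) matrices)

  D : Carrier → Subset
  D i x = does (det x ≟ i)

  _∩_ : Subset → Subset → Subset
  (S ∩ T) x = S x ∧ T x

  ProductType : Subset → Set
  ProductType S = Σ (Vec2 → Bool) λ S₁ → Σ (Vec2 → Bool) λ S₂ →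
                    ∀ x → S x ≡ (S₁ (row₁ x) ∧ S₂ (row₂ x))

-- Write S = S₁ × S₂ and, for a row u, let hits u be the number of v ∈ S₂ with det (u , v) = i,
-- so that |S ∩ Dᵢ| = Σ_{u ∈ S₁} hits u and |S| = |S₁||S₂|.  Cauchy–Schwarz over u ∈ S₁ gives
--   (q|S ∩ Dᵢ| − |S|)² = (Σ_{u ∈ S₁} (q · hits u − |S₂|))² ≤ |S₁| · Σ_{u ∈ F²} (q · hits u − |S₂|)²,
-- so it suffices to bound the last sum by q³|S₂|.  For v ≠ 0 the solutions of det (u , v) = i
-- form a line with q points, two such lines for v ≠ w meet in at most one point (Cramer's rule,
-- using i ≠ 0), and for v = 0 there are none.  With n = |S₂ ∖ {0}| this gives Σ hits = q n and
-- Σ hits² ≤ n² + (q − 1) n, and expanding the square yields the bound.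

module Submission where

open import Defs
open import Algebra.Bundles using (CommutativeRing)

-- Coefficients in ℤ let normalisation cancel x - x.  With the type-checking-optimised _×_,
-- ⟦ 1ℤ ⟧ℤ and ⟦ 0ℤ ⟧ℤ are definitionally 1# and 0#, so con 1ℤ and con 0ℤ stand for them.
module IntegerCoefficientRingSolver {c ℓ} (R : CommutativeRing c ℓ) where

  open import Data.Nat as ℕ using (zero; suc)
  open import Data.Integer as ℤ using (ℤ; +_; -[1+_]; _⊖_)
  import Data.Integer.Properties as ℤ
  import Data.Nat.Properties as ℕ
  open import Data.Sign as Sign using (Sign)
  open import Data.Maybe as Maybe using (Maybe)
  open import Relation.Binary.Consequences using (dec⇒weaklyDec)
  import Relation.Binary.PropositionalEquality as ≡
  open import Algebra.Solver.Ring.AlmostCommutativeRing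
    using (_-Raw-AlmostCommutative⟶_; fromCommutativeRing)

  open CommutativeRing R
  open import Algebra.Properties.Semiring.Mult.TCOptimised semiring using (_×_; 1+×; ×-homo-+; ×1-homo-*)
  open import Algebra.Properties.Ring ring using (-‿distribˡ-*; -‿distribʳ-*; -0#≈0#; -‿involutive; -‿+-comm)
  open import Algebra.Properties.CommutativeSemigroup +-commutativeSemigroup using (interchange)
  open import Relation.Binary.Reasoning.Setoid setoid

  signed : Sign → Carrier → Carrier
  signed Sign.+ x = x
  signed Sign.- x = - x

  ⟦_⟧ℤ : ℤ → Carrier
  ⟦ i ⟧ℤ = signed (ℤ.sign i) (ℤ.∣ i ∣ × 1#)

  ⟦◃⟧ : ∀ s n → ⟦ s ℤ.◃ n ⟧ℤ ≈ signed s (n × 1#)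
  ⟦◃⟧ Sign.+ zero    = refl
  ⟦◃⟧ Sign.- zero    = sym -0#≈0#
  ⟦◃⟧ Sign.+ (suc n) = refl
  ⟦◃⟧ Sign.- (suc n) = refl

  signed-* : ∀ s t x y → signed (s Sign.* t) (x * y) ≈ signed s x * signed t y
  signed-* Sign.+ Sign.+ x y = refl
  signed-* Sign.+ Sign.- x y = -‿distribʳ-* x y
  signed-* Sign.- Sign.+ x y = -‿distribˡ-* x y
  signed-* Sign.- Sign.- x y = begin
    x * y         ≈⟨ -‿involutive (x * y) ⟨
    - (- (x * y)) ≈⟨ -‿cong (-‿distribʳ-* x y) ⟩
    - (x * - y)   ≈⟨ -‿distribˡ-* x (- y) ⟩
    - x * - y     ∎

  *-homo : ∀ i j → ⟦ i ℤ.* j ⟧ℤ ≈ ⟦ i ⟧ℤ * ⟦ j ⟧ℤ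
  *-homo i j = begin
    ⟦ s ℤ.◃ ℤ.∣ i ∣ ℕ.* ℤ.∣ j ∣ ⟧ℤ                 ≈⟨ ⟦◃⟧ s (ℤ.∣ i ∣ ℕ.* ℤ.∣ j ∣) ⟩
    signed s ((ℤ.∣ i ∣ ℕ.* ℤ.∣ j ∣) × 1#)          ≈⟨ signed-cong s (×1-homo-* ℤ.∣ i ∣ ℤ.∣ j ∣) ⟩
    signed s ((ℤ.∣ i ∣ × 1#) * (ℤ.∣ j ∣ × 1#))     ≈⟨ signed-* (ℤ.sign i) (ℤ.sign j) _ _ ⟩
    ⟦ i ⟧ℤ * ⟦ j ⟧ℤ                                ∎
    where
    s = ℤ.sign i Sign.* ℤ.sign j
    signed-cong : ∀ s {x y} → x ≈ y → signed s x ≈ signed s y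
    signed-cong Sign.+ x≈y = x≈y
    signed-cong Sign.- x≈y = -‿cong x≈y

  ⊖-homo : ∀ m n → ⟦ m ⊖ n ⟧ℤ ≈ m × 1# - n × 1#
  ⊖-homo m zero = begin
    ⟦ m ⊖ 0 ⟧ℤ      ≡⟨ ≡.cong ⟦_⟧ℤ (ℤ.⊖-≥ {m} ℕ.z≤n) ⟩
    m × 1#          ≈⟨ +-identityʳ (m × 1#) ⟨
    m × 1# + 0#     ≈⟨ +-congˡ -0#≈0# ⟨
    m × 1# - 0#     ∎
  ⊖-homo zero (suc n) = sym (+-identityˡ _)
  ⊖-homo (suc m) (suc n) = begin
    ⟦ suc m ⊖ suc n ⟧ℤ                  ≡⟨ ≡.cong ⟦_⟧ℤ (ℤ.[1+m]⊖[1+n]≡m⊖n m n) ⟩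
    ⟦ m ⊖ n ⟧ℤ                          ≈⟨ ⊖-homo m n ⟩
    m × 1# - n × 1#                     ≈⟨ +-identityˡ _ ⟨
    0# + (m × 1# - n × 1#)              ≈⟨ +-congʳ (-‿inverseʳ 1#) ⟨
    (1# - 1#) + (m × 1# - n × 1#)       ≈⟨ interchange 1# (- 1#) (m × 1#) (- (n × 1#)) ⟩
    (1# + m × 1#) + (- 1# - n × 1#)     ≈⟨ +-congˡ (-‿+-comm 1# (n × 1#)) ⟩
    (1# + m × 1#) - (1# + n × 1#)       ≈⟨ +-cong (1+× m 1#) (-‿cong (1+× n 1#)) ⟨
    suc m × 1# - suc n × 1#             ∎

  +-homo : ∀ i j → ⟦ i ℤ.+ j ⟧ℤ ≈ ⟦ i ⟧ℤ + ⟦ j ⟧ℤ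
  +-homo (+ m)    (+ n)    = ×-homo-+ 1# m n
  +-homo (+ m)    -[1+ n ] = ⊖-homo m (suc n)
  +-homo -[1+ m ] (+ n)    = trans (⊖-homo n (suc m)) (+-comm _ _)
  +-homo -[1+ m ] -[1+ n ] = begin
    - (suc (suc (m ℕ.+ n)) × 1#)         ≡⟨ ≡.cong (λ k → - (suc k × 1#)) (≡.sym (ℕ.+-suc m n)) ⟩
    - ((suc m ℕ.+ suc n) × 1#)           ≈⟨ -‿cong (×-homo-+ 1# (suc m) (suc n)) ⟩
    - (suc m × 1# + suc n × 1#)          ≈⟨ -‿+-comm _ _ ⟨
    - (suc m × 1#) + - (suc n × 1#)      ∎

  -‿homo : ∀ i → ⟦ ℤ.- i ⟧ℤ ≈ - ⟦ i ⟧ℤ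
  -‿homo (+ zero)    = sym -0#≈0#
  -‿homo (+ suc n)   = refl
  -‿homo -[1+ n ]    = sym (-‿involutive _)

  ℤ⟶R : ℤ.+-*-rawRing -Raw-AlmostCommutative⟶ fromCommutativeRing R
  ℤ⟶R = record
    { ⟦_⟧ = ⟦_⟧ℤ ; +-homo = +-homo ; *-homo = *-homo ; -‿homo = -‿homo
    ; 0-homo = refl ; 1-homo = refl }

  ⟦⟧-weaklyDecidable : ∀ i j → Maybe (⟦ i ⟧ℤ ≈ ⟦ j ⟧ℤ)
  ⟦⟧-weaklyDecidable i j = Maybe.map (λ { ≡.refl → refl }) (dec⇒weaklyDec ℤ._≟_ i j)

  open import Algebra.Solver.Ring ℤ.+-*-rawRing (fromCommutativeRing R) ℤ⟶R ⟦⟧-weaklyDecidable public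


module FieldAlgebra (F : FiniteField) where

  open import Data.Product using (_,_; proj₁; proj₂; ∃!)
  open import Data.Empty using (⊥-elim)
  open import Function using (case_of_)
  open import Relation.Binary.PropositionalEquality
    using (_≡_; _≢_; refl; sym; trans; cong; cong₂; module ≡-Reasoning)
  open import Relation.Nullary using (yes; no)
  open import Data.Integer using (0ℤ; 1ℤ)

  open FiniteField F
  open Matrices F using (det)

  commutativeRing : CommutativeRing _ _
  commutativeRing = record { isCommutativeRing = isCommutativeRing }

  open CommutativeRing commutativeRing using (*-identityʳ; *-assoc; zeroʳ)
  open import Algebra.Properties.Ring (CommutativeRing.ring commutativeRing)
    using (-‿involutive; -0#≈0#; +-cancelʳ; x∙y⁻¹≈ε⇒x≈y)
  open IntegerCoefficientRingSolver commutativeRing using (solve; _:=_; _:+_; _:*_; :-_; _:-_; con)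
  open ≡-Reasoning

  *-cancelʳ-≢0 : ∀ {x} y z → x ≢ 0# → y * x ≡ z * x → y ≡ z
  *-cancelʳ-≢0 {x} y z x≢0 yx≡zx = begin
    y             ≡⟨ undo y ⟨
    y * x * x⁻¹   ≡⟨ cong (_* x⁻¹) yx≡zx ⟩
    z * x * x⁻¹   ≡⟨ undo z ⟩
    z             ∎
    where
    x⁻¹ = proj₁ (inverse x x≢0)
    undo : ∀ y → y * x * x⁻¹ ≡ y
    undo y = trans (*-assoc y x x⁻¹) (trans (cong (y *_) (proj₂ (inverse x x≢0))) (*-identityʳ y))

  -≢0 : ∀ {x} → x ≢ 0# → - x ≢ 0#
  -≢0 {x} x≢0 -x≡0 = x≢0 (trans (sym (-‿involutive x)) (trans (cong -_ -x≡0) -0#≈0#))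

  affine-root : ∀ {α} → α ≢ 0# → ∀ β γ → ∃! _≡_ (λ x → x * α + β ≡ γ)
  affine-root {α} α≢0 β γ = x₀ , root , λ {x} x-root →
    *-cancelʳ-≢0 x₀ x α≢0 (+-cancelʳ β (x₀ * α) (x * α) (trans root (sym x-root)))
    where
    α⁻¹ = proj₁ (inverse α α≢0)
    x₀ = (γ - β) * α⁻¹
    root : x₀ * α + β ≡ γ
    root = begin
      (γ - β) * α⁻¹ * α + β     ≡⟨ solve 4 (λ α α⁻¹ β γ → (γ :- β) :* α⁻¹ :* α :+ β := (γ :- β) :* (α :* α⁻¹) :+ β) refl α α⁻¹ β γ ⟩
      (γ - β) * (α * α⁻¹) + β   ≡⟨ cong (λ e → (γ - β) * e + β) (proj₂ (inverse α α≢0)) ⟩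
      (γ - β) * 1# + β          ≡⟨ solve 2 (λ β γ → (γ :- β) :* con 1ℤ :+ β := γ) refl β γ ⟩
      γ                         ∎

  det-unique-in-a : ∀ {d} → d ≢ 0# → ∀ b c i → ∃! _≡_ (λ a → det ((a , b) , (c , d)) ≡ i)
  det-unique-in-a d≢0 b c = affine-root d≢0 (- (b * c))

  det-unique-in-b : ∀ {c} → c ≢ 0# → ∀ a d i → ∃! _≡_ (λ b → det ((a , b) , (c , d)) ≡ i)
  det-unique-in-b {c} c≢0 a d i =
    let b₀ , root , unique = affine-root (-≢0 c≢0) (a * d) i
    in  b₀ , trans (as-affine b₀) root , λ b-root → unique (trans (sym (as-affine _)) b-root)
    where
    as-affine : ∀ b → det ((a , b) , (c , d)) ≡ b * - c + a * d
    as-affine b = solve 4 (λ a b c d → a :* d :- b :* c := b :* (:- c) :+ a :* d) refl a b c d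

  det-zeroʳ : ∀ u → det (u , (0# , 0#)) ≡ 0#
  det-zeroʳ (a , b) = solve 2 (λ a b → a :* con 0ℤ :- b :* con 0ℤ := con 0ℤ) refl a b

  cramerˡ : ∀ a b c d c′ d′ →
            a * det ((c , d) , (c′ , d′)) ≡ c * det ((a , b) , (c′ , d′)) - c′ * det ((a , b) , (c , d))
  cramerˡ = solve 6 (λ a b c d c′ d′ →
    a :* (c :* d′ :- d :* c′) := c :* (a :* d′ :- b :* c′) :- c′ :* (a :* d :- b :* c)) refl

  cramerʳ : ∀ a b c d c′ d′ →
            b * det ((c , d) , (c′ , d′)) ≡ d * det ((a , b) , (c′ , d′)) - d′ * det ((a , b) , (c , d))
  cramerʳ = solve 6 (λ a b c d c′ d′ →
    b :* (c :* d′ :- d :* c′) := d :* (a :* d′ :- b :* c′) :- d′ :* (a :* d :- b :* c)) refl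

  common-root-unique : ∀ {i} → i ≢ 0# → ∀ {v w} → v ≢ w → ∀ {u u′} →
                       det (u , v) ≡ i → det (u , w) ≡ i → det (u′ , v) ≡ i → det (u′ , w) ≡ i → u ≡ u′
  common-root-unique {i} i≢0 {c , d} {c′ , d′} v≢w {a , b} {a′ , b′} uv uw u′v u′w =
    case Δ ≟ 0# of λ where
      (yes Δ≡0) → ⊥-elim (v≢w (cong₂ _,_ (degenerate Δ≡0 a-eq) (degenerate Δ≡0 b-eq)))
      (no Δ≢0)  → cong₂ _,_ (*-cancelʳ-≢0 a a′ Δ≢0 (trans a-eq (sym a′-eq)))
                            (*-cancelʳ-≢0 b b′ Δ≢0 (trans b-eq (sym b′-eq)))
    where
    -- When det (v , w) = 0, the Cramer identities evaluated at i ≠ 0 force v = w.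
    Δ = det ((c , d) , (c′ , d′))
    at-i : ∀ {x y y′ s t} → s ≡ i → t ≡ i → x * Δ ≡ y * s - y′ * t → x * Δ ≡ y * i - y′ * i
    at-i refl refl e = e
    a-eq  = at-i uw  uv  (cramerˡ a  b  c d c′ d′)
    b-eq  = at-i uw  uv  (cramerʳ a  b  c d c′ d′)
    a′-eq = at-i u′w u′v (cramerˡ a′ b′ c d c′ d′)
    b′-eq = at-i u′w u′v (cramerʳ a′ b′ c d c′ d′)
    degenerate : ∀ {x y y′} → Δ ≡ 0# → x * Δ ≡ y * i - y′ * i → y ≡ y′
    degenerate {x} {y} {y′} Δ≡0 e =
      *-cancelʳ-≢0 y y′ i≢0 (x∙y⁻¹≈ε⇒x≈y _ _ (trans (sym e) (trans (cong (x *_) Δ≡0) (zeroʳ x))))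

open import Data.Bool as Bool using (Bool; true; false; _∧_; not)
open import Data.Bool.Properties using (∧-zeroʳ; ∧-identityʳ)
open import Data.Empty using (⊥-elim)
open import Data.Fin.Properties using (toℕ<n)
open import Data.Integer using (ℤ; +_; _-_; _*_; _^_; _≤_; 0ℤ; 1ℤ; _+_; -_; +≤+; -[1+_]; nonNegative)
open import Data.Integer.Properties
  using (+-identityʳ; +-identityˡ; +-assoc; *-identityˡ; *-identityʳ; *-zeroˡ; *-zeroʳ; *-distribˡ-+;
         *-comm; *-assoc; suc-*; pos-*; +-mono-≤; +-monoˡ-≤; *-monoˡ-≤-nonNeg; ≤-refl; ≤-trans;
         ≤-reflexive; i≤i+j; i≤j⇒0≤j-i; 0≤i-j⇒j≤i; module ≤-Reasoning)
open import Data.Integer.Tactic.RingSolver using (solve-∀)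
open import Data.List using (List; []; _∷_; _++_; map; concatMap; length; filter; allFin; cartesianProduct)
open import Data.List.Membership.Propositional using (_∈_)
open import Data.List.Membership.Propositional.Properties using (∈-map⁺; ∈-allFin; ∈-cartesianProduct⁺)
open import Data.List.Properties using (length-map; length-tabulate)
open import Data.List.Relation.Unary.All as All using (All; []; _∷_)
open import Data.List.Relation.Unary.AllPairs using ([]; _∷_)
open import Data.List.Relation.Unary.Any using (here; there)
open import Data.List.Relation.Unary.Unique.Propositional using (Unique)
import Data.List.Relation.Unary.Unique.Propositional.Properties as Unique
import Data.Nat as ℕ
import Data.Nat.Properties as ℕ
open import Data.Product using (_,_; _×_; ∃!)
open import Data.Product.Properties using (≡-dec)
open import Function using (_∘_; id; case_of_; Inverse; Injection)
open import Function.Properties.Inverse using (↔-sym; Inverse⇒Injection)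
open import Level using (0ℓ)
open import Relation.Binary.Definitions using (DecidableEquality)
open import Relation.Binary.PropositionalEquality
  using (_≡_; _≢_; refl; sym; trans; cong; cong₂; subst; module ≡-Reasoning)
open import Relation.Nullary using (Dec; does; yes; no; _×-dec_)
open import Relation.Nullary.Decidable using (dec-true; dec-false)
open import Relation.Unary using (Pred; Decidable)

∑ : {A : Set} → List A → (A → ℤ) → ℤ
∑ []       f = 0ℤ
∑ (x ∷ xs) f = f x + ∑ xs f

syntax ∑ xs (λ x → e) = ∑[ x ∈ xs ] e

module _ {A : Set} where

  ∑-cong : ∀ xs {f g : A → ℤ} → (∀ x → f x ≡ g x) → ∑ xs f ≡ ∑ xs g
  ∑-cong []       f≗g = refl
  ∑-cong (x ∷ xs) f≗g = cong₂ _+_ (f≗g x) (∑-cong xs f≗g)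

  ∑-distrib-+ : ∀ xs (f g : A → ℤ) → ∑[ x ∈ xs ] (f x + g x) ≡ ∑ xs f + ∑ xs g
  ∑-distrib-+ []       f g = refl
  ∑-distrib-+ (x ∷ xs) f g = trans (cong (_+_ (f x + g x)) (∑-distrib-+ xs f g))
                                   (+-interchange (f x) (g x) (∑ xs f) (∑ xs g))
    where
    +-interchange : ∀ a b c d → (a + b) + (c + d) ≡ (a + c) + (b + d)
    +-interchange = solve-∀

  *-distribˡ-∑ : ∀ c xs (f : A → ℤ) → c * ∑ xs f ≡ ∑[ x ∈ xs ] (c * f x)
  *-distribˡ-∑ c []       f = *-zeroʳ c
  *-distribˡ-∑ c (x ∷ xs) f = trans (*-distribˡ-+ c (f x) (∑ xs f)) (cong (_+_ (c * f x)) (*-distribˡ-∑ c xs f))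

  ∑-linear : ∀ xs a b (f g : A → ℤ) →
             ∑[ x ∈ xs ] (a * f x + b * g x) ≡ a * ∑ xs f + b * ∑ xs g
  ∑-linear xs a b f g = trans (∑-distrib-+ xs (λ x → a * f x) (λ x → b * g x))
                              (sym (cong₂ _+_ (*-distribˡ-∑ a xs f) (*-distribˡ-∑ b xs g)))

  ∑-linear₃ : ∀ xs a b c (f g h : A → ℤ) →
              ∑[ x ∈ xs ] (a * f x + b * g x + c * h x) ≡ a * ∑ xs f + b * ∑ xs g + c * ∑ xs h
  ∑-linear₃ xs a b c f g h = begin
    ∑[ x ∈ xs ] (a * f x + b * g x + c * h x)                ≡⟨ ∑-distrib-+ xs (λ x → a * f x + b * g x) (λ x → c * h x) ⟩
    ∑[ x ∈ xs ] (a * f x + b * g x) + ∑[ x ∈ xs ] (c * h x)  ≡⟨ cong₂ _+_ (∑-linear xs a b f g) (sym (*-distribˡ-∑ c xs h)) ⟩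
    a * ∑ xs f + b * ∑ xs g + c * ∑ xs h                     ∎
    where open ≡-Reasoning

  ∑-const : ∀ (xs : List A) c → ∑[ x ∈ xs ] c ≡ + length xs * c
  ∑-const []       c = sym (*-zeroˡ c)
  ∑-const (x ∷ xs) c = trans (cong (_+_ c) (∑-const xs c)) (sym (suc-* (+ length xs) c))

  ∑-zero : ∀ (xs : List A) → ∑[ x ∈ xs ] 0ℤ ≡ 0ℤ
  ∑-zero xs = trans (∑-const xs 0ℤ) (*-zeroʳ (+ length xs))

  ∑-mono-≤ : ∀ xs {f g : A → ℤ} → (∀ x → f x ≤ g x) → ∑ xs f ≤ ∑ xs g
  ∑-mono-≤ []       f≤g = ≤-refl
  ∑-mono-≤ (x ∷ xs) f≤g = +-mono-≤ (f≤g x) (∑-mono-≤ xs f≤g)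

  ∑-nonneg : ∀ xs {f : A → ℤ} → (∀ x → 0ℤ ≤ f x) → 0ℤ ≤ ∑ xs f
  ∑-nonneg []       0≤f = ≤-refl
  ∑-nonneg (x ∷ xs) 0≤f = +-mono-≤ (0≤f x) (∑-nonneg xs 0≤f)

  ∑-++ : ∀ xs ys (f : A → ℤ) → ∑ (xs ++ ys) f ≡ ∑ xs f + ∑ ys f
  ∑-++ []       ys f = sym (+-identityˡ _)
  ∑-++ (x ∷ xs) ys f = trans (cong (_+_ (f x)) (∑-++ xs ys f)) (sym (+-assoc (f x) _ _))

  ∑-map : ∀ {B : Set} (g : A → B) xs (f : B → ℤ) → ∑ (map g xs) f ≡ ∑[ x ∈ xs ] f (g x)
  ∑-map g []       f = refl
  ∑-map g (x ∷ xs) f = cong (_+_ (f (g x))) (∑-map g xs f)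

module _ {A B : Set} where

  ∑-comm : ∀ xs ys (f : A → B → ℤ) → ∑[ x ∈ xs ] ∑[ y ∈ ys ] f x y ≡ ∑[ y ∈ ys ] ∑[ x ∈ xs ] f x y
  ∑-comm []       ys f = sym (∑-zero ys)
  ∑-comm (x ∷ xs) ys f = trans (cong (_+_ (∑ ys (f x))) (∑-comm xs ys f))
                               (sym (∑-distrib-+ ys (f x) (λ y → ∑[ x ∈ xs ] f x y)))

  ∑-*-∑ : ∀ xs ys (f : A → ℤ) (g : B → ℤ) → ∑ xs f * ∑ ys g ≡ ∑[ x ∈ xs ] ∑[ y ∈ ys ] (f x * g y)
  ∑-*-∑ xs ys f g = begin
    ∑ xs f * ∑ ys g                     ≡⟨ *-comm (∑ xs f) (∑ ys g) ⟩
    ∑ ys g * ∑ xs f                     ≡⟨ *-distribˡ-∑ (∑ ys g) xs f ⟩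
    ∑[ x ∈ xs ] (∑ ys g * f x)          ≡⟨ ∑-cong xs (λ x → *-comm (∑ ys g) (f x)) ⟩
    ∑[ x ∈ xs ] (f x * ∑ ys g)          ≡⟨ ∑-cong xs (λ x → *-distribˡ-∑ (f x) ys g) ⟩
    ∑[ x ∈ xs ] ∑[ y ∈ ys ] (f x * g y) ∎
    where open ≡-Reasoning

  concatMap-map≡cartesianProduct : ∀ (xs : List A) (ys : List B) →
                                   concatMap (λ x → map (x ,_) ys) xs ≡ cartesianProduct xs ys
  concatMap-map≡cartesianProduct []       ys = refl
  concatMap-map≡cartesianProduct (x ∷ xs) ys = cong (map (x ,_) ys ++_) (concatMap-map≡cartesianProduct xs ys)

  ∑-cartesianProduct : ∀ xs ys (f : A × B → ℤ) →
                       ∑ (cartesianProduct xs ys) f ≡ ∑[ x ∈ xs ] ∑[ y ∈ ys ] f (x , y)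
  ∑-cartesianProduct []       ys f = refl
  ∑-cartesianProduct (x ∷ xs) ys f = begin
    ∑ (map (x ,_) ys ++ cartesianProduct xs ys) f       ≡⟨ ∑-++ (map (x ,_) ys) _ f ⟩
    ∑ (map (x ,_) ys) f + ∑ (cartesianProduct xs ys) f  ≡⟨ cong₂ _+_ (∑-map (x ,_) ys f) (∑-cartesianProduct xs ys f) ⟩
    ∑[ y ∈ ys ] f (x , y) + ∑[ x ∈ xs ] ∑[ y ∈ ys ] f (x , y) ∎
    where open ≡-Reasoning

𝟙 : Bool → ℤ
𝟙 true  = 1ℤ
𝟙 false = 0ℤ

0≤𝟙 : ∀ b → 0ℤ ≤ 𝟙 b
0≤𝟙 true  = +≤+ ℕ.z≤n
0≤𝟙 false = +≤+ ℕ.z≤n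

𝟙-∧ : ∀ a b → 𝟙 (a ∧ b) ≡ 𝟙 a * 𝟙 b
𝟙-∧ true  b = sym (*-identityˡ (𝟙 b))
𝟙-∧ false b = refl

𝟙-idem : ∀ b → 𝟙 b * 𝟙 b ≡ 𝟙 b
𝟙-idem true  = refl
𝟙-idem false = refl

𝟙-⇔ : ∀ {P Q : Set} (P? : Dec P) (Q? : Dec Q) → (P → Q) → (Q → P) → 𝟙 (does P?) ≡ 𝟙 (does Q?)
𝟙-⇔ (yes _) (yes _) P→Q Q→P = refl
𝟙-⇔ (no _)  (no _)  P→Q Q→P = refl
𝟙-⇔ (yes p) (no ¬q) P→Q Q→P = ⊥-elim (¬q (P→Q p))
𝟙-⇔ (no ¬p) (yes q) P→Q Q→P = ⊥-elim (¬p (Q→P q))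

𝟙-*-cong : ∀ b {x y} → (b ≡ true → x ≡ y) → 𝟙 b * x ≡ 𝟙 b * y
𝟙-*-cong true  x≡y = cong (1ℤ *_) (x≡y refl)
𝟙-*-cong false x≡y = refl

𝟙-*-mono-≤ : ∀ b {x y} → (b ≡ true → x ≤ y) → 𝟙 b * x ≤ 𝟙 b * y
𝟙-*-mono-≤ true  x≤y = *-monoˡ-≤-nonNeg 1ℤ (x≤y refl)
𝟙-*-mono-≤ false x≤y = ≤-refl

𝟙-split : ∀ a e → 𝟙 a ≡ 𝟙 (a ∧ not e) + 𝟙 e * 𝟙 a
𝟙-split true  true  = refl
𝟙-split true  false = refl
𝟙-split false true  = refl
𝟙-split false false = refl

module _ {A : Set} where

  length-filter : ∀ (p : A → Bool) xs →
                  + length (filter (λ x → p x Bool.≟ true) xs) ≡ ∑[ x ∈ xs ] 𝟙 (p x)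
  length-filter p []       = refl
  length-filter p (x ∷ xs) with p x
  ... | true  = cong (_+_ 1ℤ) (length-filter p xs)
  ... | false = trans (length-filter p xs) (sym (+-identityˡ _))

  ∑-allZero : ∀ {xs} {f : A → ℤ} → All (λ x → f x ≡ 0ℤ) xs → ∑ xs f ≡ 0ℤ
  ∑-allZero []           = refl
  ∑-allZero (fx≡0 ∷ f≡0) = cong₂ _+_ fx≡0 (∑-allZero f≡0)

  module _ (_≟_ : DecidableEquality A) where

    ∑-𝟙-≟ : ∀ {xs x₀} → Unique xs → x₀ ∈ xs → (h : A → ℤ) →
            ∑[ x ∈ xs ] (𝟙 (does (x ≟ x₀)) * h x) ≡ h x₀
    ∑-𝟙-≟ {x ∷ xs} (x∉xs ∷ _) (here refl) h = begin
      𝟙 (does (x ≟ x)) * h x + ∑[ y ∈ xs ] (𝟙 (does (y ≟ x)) * h y)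
        ≡⟨ cong₂ (λ b s → 𝟙 b * h x + s) (dec-true (x ≟ x) refl) (∑-allZero (All.map off x∉xs)) ⟩
      1ℤ * h x + 0ℤ
        ≡⟨ trans (+-identityʳ _) (*-identityˡ (h x)) ⟩
      h x ∎
      where
      open ≡-Reasoning
      off : ∀ {y} → x ≢ y → 𝟙 (does (y ≟ x)) * h y ≡ 0ℤ
      off x≢y = cong (λ b → 𝟙 b * h _) (dec-false (_ ≟ x) (x≢y ∘ sym))
    ∑-𝟙-≟ {x ∷ xs} {x₀} (x∉xs ∷ xs!) (there x₀∈xs) h =
      trans (cong₂ (λ b s → 𝟙 b * h x + s) (dec-false (x ≟ x₀) (All.lookup x∉xs x₀∈xs)) (∑-𝟙-≟ xs! x₀∈xs h))
            (+-identityˡ (h x₀))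

  ∑-𝟙-atMostOne : ∀ {P : Pred A 0ℓ} (P? : Decidable P) → (∀ {x y} → P x → P y → x ≡ y) →
                  ∀ {xs} → Unique xs → ∑[ x ∈ xs ] 𝟙 (does (P? x)) ≤ 1ℤ
  ∑-𝟙-atMostOne P? P-unique {[]}     []          = +≤+ ℕ.z≤n
  ∑-𝟙-atMostOne P? P-unique {x ∷ xs} (x∉xs ∷ xs!) with P? x
  ... | yes Px = ≤-reflexive (cong (_+_ 1ℤ) (∑-allZero (All.map off x∉xs)))
    where
    off : ∀ {y} → x ≢ y → 𝟙 (does (P? y)) ≡ 0ℤ
    off x≢y = cong 𝟙 (dec-false (P? _) (λ Py → x≢y (P-unique Px Py)))
  ... | no ¬Px = ≤-trans (≤-reflexive (+-identityˡ _)) (∑-𝟙-atMostOne P? P-unique xs!)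

0≤* : ∀ {i j} → 0ℤ ≤ i → 0ℤ ≤ j → 0ℤ ≤ i * j
0≤* {+ m} {+ n} _ _ = subst (0ℤ ≤_) (pos-* m n) (+≤+ ℕ.z≤n)

0≤i*i : ∀ i → 0ℤ ≤ i * i
0≤i*i (+ n)      = 0≤* {+ n} {+ n} (+≤+ ℕ.z≤n) (+≤+ ℕ.z≤n)
0≤i*i -[1+ n ]   = +≤+ ℕ.z≤n

module _ {A : Set} where

  cauchy-schwarz : ∀ xs (f g : A → ℤ) →
                   ∑[ x ∈ xs ] (f x * g x) * ∑[ x ∈ xs ] (f x * g x)
                     ≤ ∑[ x ∈ xs ] (f x * f x) * ∑[ x ∈ xs ] (g x * g x)
  cauchy-schwarz []       f g = ≤-refl
  cauchy-schwarz (x ∷ xs) f g =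
    0≤i-j⇒j≤i (subst (0ℤ ≤_) (gap a b C P Q) (+-mono-≤ (i≤j⇒0≤j-i (cauchy-schwarz xs f g)) cross))
    where
    a = f x
    b = g x
    C = ∑[ y ∈ xs ] (f y * g y)
    P = ∑[ y ∈ xs ] (f y * f y)
    Q = ∑[ y ∈ xs ] (g y * g y)
    square : ∀ a b u v → (a * v - b * u) * (a * v - b * u) ≡ (a * a) * (v * v) + (b * b) * (u * u) + (- (a * b + a * b)) * (u * v)
    square = solve-∀
    cross : 0ℤ ≤ (a * a) * Q + (b * b) * P + (- (a * b + a * b)) * C
    cross = subst (0ℤ ≤_)
                  (trans (∑-cong xs (λ y → square a b (f y) (g y)))
                         (∑-linear₃ xs (a * a) (b * b) (- (a * b + a * b)) (λ y → g y * g y) (λ y → f y * f y) (λ y → f y * g y)))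
                  (∑-nonneg xs (λ y → 0≤i*i (a * g y - b * f y)))
    gap : ∀ a b C P Q → P * Q - C * C + ((a * a) * Q + (b * b) * P + (- (a * b + a * b)) * C)
                        ≡ (a * a + P) * (b * b + Q) - (a * b + C) * (a * b + C)
    gap = solve-∀

i+j≡k⇒i≤k : ∀ {i j k} → i + j ≡ k → 0ℤ ≤ j → i ≤ k
i+j≡k⇒i≤k {i} {j} i+j≡k 0≤j = subst (i ≤_) i+j≡k (i≤i+j i j {{nonNegative 0≤j}})

module _ {A : Set} where

  deviation-bound : ∀ xs (f : A → ℤ) {q n} (b : Bool) → 1ℤ ≤ q → 0ℤ ≤ n →
                    ∑[ x ∈ xs ] 1ℤ ≡ q * q → ∑ xs f ≡ q * n →
                    ∑[ x ∈ xs ] (f x * f x) ≤ n * n + (q - 1ℤ) * n →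
                    ∑[ x ∈ xs ] ((q * f x - (n + 𝟙 b)) * (q * f x - (n + 𝟙 b))) ≤ q * q * q * (n + 𝟙 b)
  deviation-bound xs f {q} {n} b 1≤q 0≤n ∑1 ∑f ∑f² = begin
    ∑[ x ∈ xs ] ((q * f x - B) * (q * f x - B))
      ≡⟨ ∑-cong xs (λ x → expand q (f x) B) ⟩
    ∑[ x ∈ xs ] ((q * q) * (f x * f x) + (- (q * B + q * B)) * f x + (B * B) * 1ℤ)
      ≡⟨ ∑-linear₃ xs (q * q) (- (q * B + q * B)) (B * B) (λ x → f x * f x) f (λ _ → 1ℤ) ⟩
    (q * q) * ∑[ x ∈ xs ] (f x * f x) + (- (q * B + q * B)) * ∑ xs f + (B * B) * ∑[ x ∈ xs ] 1ℤ
      ≡⟨ cong₂ (λ s s₀ → (q * q) * ∑[ x ∈ xs ] (f x * f x) + (- (q * B + q * B)) * s + (B * B) * s₀) ∑f ∑1 ⟩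
    (q * q) * ∑[ x ∈ xs ] (f x * f x) + (- (q * B + q * B)) * (q * n) + (B * B) * (q * q)
      ≤⟨ +-monoˡ-≤ _ (+-monoˡ-≤ _ (*-monoˡ-≤-nonNeg (q * q) {{nonNegative (0≤i*i q)}} ∑f²)) ⟩
    (q * q) * (n * n + (q - 1ℤ) * n) + (- (q * B + q * B)) * (q * n) + (B * B) * (q * q)
      ≤⟨ i+j≡k⇒i≤k exact 0≤slack ⟩
    q * q * q * B ∎
    where
    open ≤-Reasoning
    t = 𝟙 b
    B = n + t
    expand : ∀ q y B → (q * y - B) * (q * y - B) ≡ (q * q) * (y * y) + (- (q * B + q * B)) * y + (B * B) * 1ℤ
    expand = solve-∀
    identity : ∀ q n t →
      (q * q) * (n * n + (q - 1ℤ) * n) + (- (q * (n + t) + q * (n + t))) * (q * n) + ((n + t) * (n + t)) * (q * q)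
        + q * q * (n + (q - 1ℤ) * t) ≡ q * q * q * (n + t) + q * q * (t * t - t)
    identity = solve-∀
    vanish : ∀ a c t → a + c * (t - t) ≡ a
    vanish = solve-∀
    -- Using t * t ≡ t, the bound q²(t + (q - 1) n) falls short of q³(n + t) by q²(n + (q - 1) t).
    exact : (q * q) * (n * n + (q - 1ℤ) * n) + (- (q * B + q * B)) * (q * n) + (B * B) * (q * q)
              + q * q * (n + (q - 1ℤ) * t) ≡ q * q * q * B
    exact = trans (identity q n t) (trans (cong (λ s → q * q * q * B + q * q * (s - t)) (𝟙-idem b)) (vanish _ (q * q) t))
    0≤slack : 0ℤ ≤ q * q * (n + (q - 1ℤ) * t)
    0≤slack = 0≤* (0≤i*i q) (+-mono-≤ 0≤n (0≤* (i≤j⇒0≤j-i 1≤q) (0≤𝟙 b)))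

module PlaneCounting (F : FiniteField) where

  open FiniteField F using (Carrier; 0#; _≟_; order; enum; elements)
  open Matrices F using (Vec2; det; vecs; matrices; row₁; row₂; Subset; ∣_∣; _∩_; D)
  open FieldAlgebra F using (det-unique-in-a; det-unique-in-b; det-zeroʳ; common-root-unique)

  q : ℤ
  q = + order

  1≤q : 1ℤ ≤ q
  1≤q = +≤+ (ℕ.≤-trans (ℕ.s≤s ℕ.z≤n) (toℕ<n (Inverse.to enum 0#)))

  elements-unique : Unique elements
  elements-unique = Unique.map⁺ (Injection.injective (Inverse⇒Injection (↔-sym enum))) (Unique.allFin⁺ order)

  ∈-elements : ∀ x → x ∈ elements
  ∈-elements x = subst (_∈ elements) (Inverse.strictlyInverseʳ enum x)
                       (∈-map⁺ (Inverse.from enum) (∈-allFin (Inverse.to enum x)))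

  ∑-elements-const : ∀ c → ∑[ x ∈ elements ] c ≡ q * c
  ∑-elements-const c = trans (∑-const elements c)
    (cong (λ n → + n * c) (trans (length-map (Inverse.from enum) (allFin order)) (length-tabulate {n = order} id)))

  ∑-elements-1 : ∑[ x ∈ elements ] 1ℤ ≡ q
  ∑-elements-1 = trans (∑-elements-const 1ℤ) (*-identityʳ q)

  vecs≡cartesianProduct : vecs ≡ cartesianProduct elements elements
  vecs≡cartesianProduct = concatMap-map≡cartesianProduct elements elements

  vecs-unique : Unique vecs
  vecs-unique = subst Unique (sym vecs≡cartesianProduct) (Unique.cartesianProduct⁺ elements-unique elements-unique)

  ∈-vecs : ∀ v → v ∈ vecs
  ∈-vecs (a , b) = subst ((a , b) ∈_) (sym vecs≡cartesianProduct) (∈-cartesianProduct⁺ (∈-elements a) (∈-elements b))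

  ∑-vecs : ∀ f → ∑ vecs f ≡ ∑[ a ∈ elements ] ∑[ b ∈ elements ] f (a , b)
  ∑-vecs f = trans (cong (λ xs → ∑ xs f) vecs≡cartesianProduct) (∑-cartesianProduct elements elements f)

  ∑-vecs-1 : ∑[ u ∈ vecs ] 1ℤ ≡ q * q
  ∑-vecs-1 = trans (∑-vecs _) (trans (∑-cong elements (λ _ → ∑-elements-1)) (∑-elements-const q))

  ∑-matrices : ∀ f → ∑ matrices f ≡ ∑[ u ∈ vecs ] ∑[ v ∈ vecs ] f (u , v)
  ∑-matrices f = trans (cong (λ xs → ∑ xs f) (concatMap-map≡cartesianProduct vecs vecs))
                       (∑-cartesianProduct vecs vecs f)

  ∑-𝟙-root : ∀ {g : Carrier → Carrier} {γ} → ∃! _≡_ (λ x → g x ≡ γ) →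
             ∑[ x ∈ elements ] 𝟙 (does (g x ≟ γ)) ≡ 1ℤ
  ∑-𝟙-root {g} {γ} (x₀ , root , unique) = begin
    ∑[ x ∈ elements ] 𝟙 (does (g x ≟ γ))        ≡⟨ ∑-cong elements at-root ⟩
    ∑[ x ∈ elements ] (𝟙 (does (x ≟ x₀)) * 1ℤ)  ≡⟨ ∑-𝟙-≟ _≟_ elements-unique (∈-elements x₀) (λ _ → 1ℤ) ⟩
    1ℤ                                          ∎
    where
    open ≡-Reasoning
    at-root : ∀ x → 𝟙 (does (g x ≟ γ)) ≡ 𝟙 (does (x ≟ x₀)) * 1ℤ
    at-root x = trans (𝟙-⇔ (g x ≟ γ) (x ≟ x₀) (λ gx≡γ → sym (unique gx≡γ)) (λ { refl → root }))
                      (sym (*-identityʳ _))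

  _≟V_ : DecidableEquality Vec2
  _≟V_ = ≡-dec _≟_ _≟_

  δ : Vec2 → Vec2 → ℤ
  δ w v = 𝟙 (does (w ≟V v))

  0V : Vec2
  0V = (0# , 0#)

  module Lines {i : Carrier} (i≢0 : i ≢ 0#) where

    hit : Vec2 → Vec2 → ℤ
    hit u v = 𝟙 (does (det (u , v) ≟ i))

    hit-zeroʳ : ∀ u → hit u 0V ≡ 0ℤ
    hit-zeroʳ u = cong 𝟙 (dec-false (det (u , 0V) ≟ i) (λ det≡i → i≢0 (trans (sym det≡i) (det-zeroʳ u))))

    line-size : ∀ {v} → v ≢ 0V → ∑[ u ∈ vecs ] hit u v ≡ q
    line-size {c , d} v≢0 with c ≟ 0#
    ... | no c≢0 = begin
      ∑[ u ∈ vecs ] hit u (c , d)                              ≡⟨ ∑-vecs _ ⟩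
      ∑[ a ∈ elements ] ∑[ b ∈ elements ] hit (a , b) (c , d)  ≡⟨ ∑-cong elements (λ a → ∑-𝟙-root (det-unique-in-b c≢0 a d i)) ⟩
      ∑[ a ∈ elements ] 1ℤ                                     ≡⟨ ∑-elements-1 ⟩
      q                                                        ∎
      where open ≡-Reasoning
    ... | yes refl = begin
      ∑[ u ∈ vecs ] hit u (0# , d)                              ≡⟨ ∑-vecs _ ⟩
      ∑[ a ∈ elements ] ∑[ b ∈ elements ] hit (a , b) (0# , d)  ≡⟨ ∑-comm elements elements _ ⟩
      ∑[ b ∈ elements ] ∑[ a ∈ elements ] hit (a , b) (0# , d)  ≡⟨ ∑-cong elements (λ b → ∑-𝟙-root (det-unique-in-a d≢0 b 0# i)) ⟩
      ∑[ b ∈ elements ] 1ℤ                                      ≡⟨ ∑-elements-1 ⟩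
      q                                                         ∎
      where
      open ≡-Reasoning
      d≢0 : d ≢ 0#
      d≢0 d≡0 = v≢0 (cong (0# ,_) d≡0)

    intersection-≤1 : ∀ {v w} → v ≢ w → ∑[ u ∈ vecs ] (hit u v * hit u w) ≤ 1ℤ
    intersection-≤1 {v} {w} v≢w = begin
      ∑[ u ∈ vecs ] (hit u v * hit u w)   ≡⟨ ∑-cong vecs (λ u → 𝟙-∧ (does (det (u , v) ≟ i)) (does (det (u , w) ≟ i))) ⟨
      ∑[ u ∈ vecs ] 𝟙 (does (on-both u))
        ≤⟨ ∑-𝟙-atMostOne on-both (λ (uv , uw) (u′v , u′w) → common-root-unique i≢0 v≢w uv uw u′v u′w) vecs-unique ⟩
      1ℤ                              ∎
      where
      open ≤-Reasoning
      on-both : ∀ u → Dec (det (u , v) ≡ i × det (u , w) ≡ i)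
      on-both u = det (u , v) ≟ i ×-dec det (u , w) ≟ i

    intersection-bound : ∀ {v} w → v ≢ 0V → ∑[ u ∈ vecs ] (hit u v * hit u w) ≤ 1ℤ + (q - 1ℤ) * δ w v
    intersection-bound {v} w v≢0 with w ≟V v
    ... | yes refl = ≤-reflexive (begin
      ∑[ u ∈ vecs ] (hit u v * hit u v)   ≡⟨ ∑-cong vecs (λ u → 𝟙-idem (does (det (u , v) ≟ i))) ⟩
      ∑[ u ∈ vecs ] hit u v             ≡⟨ line-size v≢0 ⟩
      q                               ≡⟨ diagonal q ⟩
      1ℤ + (q - 1ℤ) * 1ℤ              ∎)
      where
      open ≡-Reasoning
      diagonal : ∀ q → q ≡ 1ℤ + (q - 1ℤ) * 1ℤ
      diagonal = solve-∀
    ... | no w≢v = ≤-trans (intersection-≤1 (w≢v ∘ sym)) (≤-reflexive (sym (off-diagonal q)))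
      where
      off-diagonal : ∀ q → 1ℤ + (q - 1ℤ) * 0ℤ ≡ 1ℤ
      off-diagonal = solve-∀

    module Hits (T : Vec2 → Bool) where

      hits : Vec2 → ℤ
      hits u = ∑[ v ∈ vecs ] (𝟙 (T v) * hit u v)

      T≢0 : Vec2 → Bool
      T≢0 v = T v ∧ not (does (v ≟V 0V))

      t : Vec2 → ℤ
      t v = 𝟙 (T≢0 v)

      n : ℤ
      n = ∑ vecs t

      T≢0-0V : T≢0 0V ≡ false
      T≢0-0V = trans (cong (λ e → T 0V ∧ not e) (dec-true (0V ≟V 0V) refl)) (∧-zeroʳ (T 0V))

      T≢0⇒≢0V : ∀ {v} → T≢0 v ≡ true → v ≢ 0V
      T≢0⇒≢0V T≢0v refl with () ← trans (sym T≢0-0V) T≢0v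

      hits-restrict : ∀ u → hits u ≡ ∑[ v ∈ vecs ] (t v * hit u v)
      hits-restrict u = ∑-cong vecs restrict
        where
        *-hit-zero : ∀ x → x * hit u 0V ≡ 0ℤ
        *-hit-zero x = trans (cong (x *_) (hit-zeroʳ u)) (*-zeroʳ x)
        restrict : ∀ v → 𝟙 (T v) * hit u v ≡ t v * hit u v
        restrict v = case v ≟V 0V of λ where
          (yes refl) → trans (*-hit-zero (𝟙 (T 0V))) (sym (*-hit-zero (t 0V)))
          (no v≢0)   → cong (λ b → 𝟙 b * hit u v)
                            (sym (trans (cong (λ e → T v ∧ not e) (dec-false (v ≟V 0V) v≢0)) (∧-identityʳ (T v))))

      ∑-T : ∑[ v ∈ vecs ] 𝟙 (T v) ≡ n + 𝟙 (T 0V)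
      ∑-T = begin
        ∑[ v ∈ vecs ] 𝟙 (T v)                               ≡⟨ ∑-cong vecs (λ v → 𝟙-split (T v) (does (v ≟V 0V))) ⟩
        ∑[ v ∈ vecs ] (t v + 𝟙 (does (v ≟V 0V)) * 𝟙 (T v))  ≡⟨ ∑-distrib-+ vecs t _ ⟩
        n + ∑[ v ∈ vecs ] (𝟙 (does (v ≟V 0V)) * 𝟙 (T v))    ≡⟨ cong (_+_ n) (∑-𝟙-≟ _≟V_ vecs-unique (∈-vecs 0V) (𝟙 ∘ T)) ⟩
        n + 𝟙 (T 0V)                                        ∎
        where open ≡-Reasoning

      weighted-line-size : ∀ v → t v * ∑[ u ∈ vecs ] hit u v ≡ t v * q
      weighted-line-size v = 𝟙-*-cong (T≢0 v) (λ T≢0v → line-size (T≢0⇒≢0V T≢0v))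

      ∑-hits : ∑[ u ∈ vecs ] hits u ≡ q * n
      ∑-hits = begin
        ∑[ u ∈ vecs ] hits u                         ≡⟨ ∑-cong vecs hits-restrict ⟩
        ∑[ u ∈ vecs ] ∑[ v ∈ vecs ] (t v * hit u v)  ≡⟨ ∑-comm vecs vecs _ ⟩
        ∑[ v ∈ vecs ] ∑[ u ∈ vecs ] (t v * hit u v)  ≡⟨ ∑-cong vecs (λ v → *-distribˡ-∑ (t v) vecs (λ u → hit u v)) ⟨
        ∑[ v ∈ vecs ] (t v * ∑[ u ∈ vecs ] hit u v)  ≡⟨ ∑-cong vecs weighted-line-size ⟩
        ∑[ v ∈ vecs ] (t v * q)                      ≡⟨ ∑-cong vecs (λ v → *-comm (t v) q) ⟩
        ∑[ v ∈ vecs ] (q * t v)                      ≡⟨ *-distribˡ-∑ q vecs t ⟨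
        q * n                                        ∎
        where open ≡-Reasoning

      intersection : Vec2 → Vec2 → ℤ
      intersection v w = ∑[ u ∈ vecs ] (hit u v * hit u w)

      weighted-intersection : ∀ v w →
        ∑[ u ∈ vecs ] ((t v * hit u v) * (t w * hit u w)) ≡ t v * (t w * intersection v w)
      weighted-intersection v w = begin
        ∑[ u ∈ vecs ] ((t v * hit u v) * (t w * hit u w))   ≡⟨ ∑-cong vecs (λ u → regroup (t v) (t w) (hit u v) (hit u w)) ⟩
        ∑[ u ∈ vecs ] ((t v * t w) * (hit u v * hit u w))   ≡⟨ *-distribˡ-∑ (t v * t w) vecs _ ⟨
        (t v * t w) * intersection v w                      ≡⟨ *-assoc (t v) (t w) (intersection v w) ⟩
        t v * (t w * intersection v w)                      ∎
        where
        open ≡-Reasoning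
        regroup : ∀ a b x y → (a * x) * (b * y) ≡ (a * b) * (x * y)
        regroup = solve-∀

      weighted-intersection-bound : ∀ v w →
        t v * (t w * intersection v w) ≤ t v * (t w * (1ℤ + (q - 1ℤ) * δ w v))
      weighted-intersection-bound v w = 𝟙-*-mono-≤ (T≢0 v) (λ T≢0v →
        *-monoˡ-≤-nonNeg (t w) {{nonNegative (0≤𝟙 (T≢0 w))}} (intersection-bound w (T≢0⇒≢0V T≢0v)))

      diagonal-row : ∀ v → ∑[ w ∈ vecs ] (t v * (t w * (1ℤ + (q - 1ℤ) * δ w v))) ≡ n * t v + (q - 1ℤ) * t v
      diagonal-row v = begin
        ∑[ w ∈ vecs ] (t v * (t w * (1ℤ + (q - 1ℤ) * δ w v)))
          ≡⟨ ∑-cong vecs (λ w → expand q (t v) (t w) (δ w v)) ⟩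
        ∑[ w ∈ vecs ] (t v * t w + ((q - 1ℤ) * t v) * (δ w v * t w))
          ≡⟨ ∑-linear vecs (t v) ((q - 1ℤ) * t v) t (λ w → δ w v * t w) ⟩
        t v * n + ((q - 1ℤ) * t v) * ∑[ w ∈ vecs ] (δ w v * t w)
          ≡⟨ cong (λ s → t v * n + ((q - 1ℤ) * t v) * s) (∑-𝟙-≟ _≟V_ vecs-unique (∈-vecs v) t) ⟩
        t v * n + ((q - 1ℤ) * t v) * t v
          ≡⟨ regroup q n (t v) ⟩
        n * t v + (q - 1ℤ) * (t v * t v)
          ≡⟨ cong (λ s → n * t v + (q - 1ℤ) * s) (𝟙-idem (T≢0 v)) ⟩
        n * t v + (q - 1ℤ) * t v
          ∎
        where
        open ≡-Reasoning
        expand : ∀ q a b e → a * (b * (1ℤ + (q - 1ℤ) * e)) ≡ a * b + ((q - 1ℤ) * a) * (e * b)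
        expand = solve-∀
        regroup : ∀ q n a → a * n + ((q - 1ℤ) * a) * a ≡ n * a + (q - 1ℤ) * (a * a)
        regroup = solve-∀

      ∑-hits² : ∑[ u ∈ vecs ] (hits u * hits u) ≤ n * n + (q - 1ℤ) * n
      ∑-hits² = begin
        ∑[ u ∈ vecs ] (hits u * hits u)
          ≡⟨ ∑-cong vecs (λ u → trans (cong₂ _*_ (hits-restrict u) (hits-restrict u))
                                      (∑-*-∑ vecs vecs (λ v → t v * hit u v) (λ w → t w * hit u w))) ⟩
        ∑[ u ∈ vecs ] ∑[ v ∈ vecs ] ∑[ w ∈ vecs ] ((t v * hit u v) * (t w * hit u w))
          ≡⟨ ∑-comm vecs vecs _ ⟩
        ∑[ v ∈ vecs ] ∑[ u ∈ vecs ] ∑[ w ∈ vecs ] ((t v * hit u v) * (t w * hit u w))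
          ≡⟨ ∑-cong vecs (λ v → ∑-comm vecs vecs _) ⟩
        ∑[ v ∈ vecs ] ∑[ w ∈ vecs ] ∑[ u ∈ vecs ] ((t v * hit u v) * (t w * hit u w))
          ≡⟨ ∑-cong vecs (λ v → ∑-cong vecs (weighted-intersection v)) ⟩
        ∑[ v ∈ vecs ] ∑[ w ∈ vecs ] (t v * (t w * intersection v w))
          ≤⟨ ∑-mono-≤ vecs (λ v → ∑-mono-≤ vecs (weighted-intersection-bound v)) ⟩
        ∑[ v ∈ vecs ] ∑[ w ∈ vecs ] (t v * (t w * (1ℤ + (q - 1ℤ) * δ w v)))
          ≡⟨ ∑-cong vecs diagonal-row ⟩
        ∑[ v ∈ vecs ] (n * t v + (q - 1ℤ) * t v)
          ≡⟨ ∑-linear vecs n (q - 1ℤ) t t ⟩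
        n * n + (q - 1ℤ) * n
          ∎
        where open ≤-Reasoning

      hits-deviation : ∑[ u ∈ vecs ] ((q * hits u - ∑[ v ∈ vecs ] 𝟙 (T v)) * (q * hits u - ∑[ v ∈ vecs ] 𝟙 (T v)))
                         ≤ q * q * q * ∑[ v ∈ vecs ] 𝟙 (T v)
      hits-deviation rewrite ∑-T =
        deviation-bound vecs hits (T 0V) 1≤q (∑-nonneg vecs (0≤𝟙 ∘ T≢0)) ∑-vecs-1 ∑-hits ∑-hits²

  module ProductSet {i : Carrier} (i≢0 : i ≢ 0#) (S : Subset) (S₁ S₂ : Vec2 → Bool)
                    (S≡ : ∀ x → S x ≡ (S₁ (row₁ x) ∧ S₂ (row₂ x))) where

    open Lines i≢0 using (hit)
    open Lines.Hits i≢0 S₂ using (hits)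

    s₁ s₂ : Vec2 → ℤ
    s₁ u = 𝟙 (S₁ u)
    s₂ v = 𝟙 (S₂ v)

    A B : ℤ
    A = ∑ vecs s₁
    B = ∑ vecs s₂

    𝟙-S : ∀ u v → 𝟙 (S (u , v)) ≡ s₁ u * s₂ v
    𝟙-S u v = trans (cong 𝟙 (S≡ (u , v))) (𝟙-∧ (S₁ u) (S₂ v))

    ∣S∣≡ : + ∣ S ∣ ≡ A * B
    ∣S∣≡ = begin
      + ∣ S ∣                                    ≡⟨ length-filter S matrices ⟩
      ∑[ m ∈ matrices ] 𝟙 (S m)                  ≡⟨ ∑-matrices _ ⟩
      ∑[ u ∈ vecs ] ∑[ v ∈ vecs ] 𝟙 (S (u , v))  ≡⟨ ∑-cong vecs (λ u → ∑-cong vecs (𝟙-S u)) ⟩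
      ∑[ u ∈ vecs ] ∑[ v ∈ vecs ] (s₁ u * s₂ v)  ≡⟨ ∑-*-∑ vecs vecs s₁ s₂ ⟨
      A * B                                      ∎
      where open ≡-Reasoning

    ∣S∩Dᵢ∣≡ : + ∣ S ∩ D i ∣ ≡ ∑[ u ∈ vecs ] (s₁ u * hits u)
    ∣S∩Dᵢ∣≡ = begin
      + ∣ S ∩ D i ∣                                            ≡⟨ length-filter (S ∩ D i) matrices ⟩
      ∑[ m ∈ matrices ] 𝟙 (S m ∧ D i m)                        ≡⟨ ∑-matrices _ ⟩
      ∑[ u ∈ vecs ] ∑[ v ∈ vecs ] 𝟙 (S (u , v) ∧ D i (u , v))  ≡⟨ ∑-cong vecs (λ u → ∑-cong vecs (split u)) ⟩
      ∑[ u ∈ vecs ] ∑[ v ∈ vecs ] (s₁ u * (s₂ v * hit u v))    ≡⟨ ∑-cong vecs (λ u → *-distribˡ-∑ (s₁ u) vecs _) ⟨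
      ∑[ u ∈ vecs ] (s₁ u * hits u)                            ∎
      where
      open ≡-Reasoning
      split : ∀ u v → 𝟙 (S (u , v) ∧ D i (u , v)) ≡ s₁ u * (s₂ v * hit u v)
      split u v = trans (𝟙-∧ (S (u , v)) (D i (u , v)))
                        (trans (cong (_* hit u v) (𝟙-S u v)) (*-assoc (s₁ u) (s₂ v) (hit u v)))

    deviation-as-sum : q * + ∣ S ∩ D i ∣ - + ∣ S ∣ ≡ ∑[ u ∈ vecs ] (s₁ u * (q * hits u - B))
    deviation-as-sum = begin
      q * + ∣ S ∩ D i ∣ - + ∣ S ∣                         ≡⟨ cong₂ (λ N s → q * N - s) ∣S∩Dᵢ∣≡ ∣S∣≡ ⟩
      q * ∑[ u ∈ vecs ] (s₁ u * hits u) - A * B           ≡⟨ regroup q (∑[ u ∈ vecs ] (s₁ u * hits u)) A B ⟩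
      q * ∑[ u ∈ vecs ] (s₁ u * hits u) + (- B) * A       ≡⟨ ∑-linear vecs q (- B) (λ u → s₁ u * hits u) s₁ ⟨
      ∑[ u ∈ vecs ] (q * (s₁ u * hits u) + (- B) * s₁ u)  ≡⟨ ∑-cong vecs (λ u → distribute q (s₁ u) (hits u) B) ⟩
      ∑[ u ∈ vecs ] (s₁ u * (q * hits u - B))             ∎
      where
      open ≡-Reasoning
      regroup : ∀ q N A B → q * N - A * B ≡ q * N + (- B) * A
      regroup = solve-∀
      distribute : ∀ q s h B → q * (s * h) + (- B) * s ≡ s * (q * h - B)
      distribute = solve-∀

lemma5p1 : (F : FiniteField) →
    IsPrimePower (FiniteField.order F) → IsOdd (FiniteField.order F) →
    (S : Matrices.Subset F) → Matrices.ProductType F S →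
    (i : FiniteField.Carrier F) → i ≢ FiniteField.0# F →
    ((+ FiniteField.order F) * (+ Matrices.∣_∣ F (Matrices._∩_ F S (Matrices.D F i)))
    - (+ Matrices.∣_∣ F S)) ^ 2
    ≤ ((+ FiniteField.order F) ^ 3) * (+ Matrices.∣_∣ F S)
lemma5p1 F _ _ S (S₁ , S₂ , S≡) i i≢0 = begin
  (q * + ∣ S ∩ D i ∣ - + ∣ S ∣) ^ 2                              ≡⟨ square (q * + ∣ S ∩ D i ∣ - + ∣ S ∣) ⟩
  (q * + ∣ S ∩ D i ∣ - + ∣ S ∣) * (q * + ∣ S ∩ D i ∣ - + ∣ S ∣)  ≡⟨ cong₂ _*_ deviation-as-sum deviation-as-sum ⟩
  ∑[ u ∈ vecs ] (s₁ u * X u) * ∑[ u ∈ vecs ] (s₁ u * X u)          ≤⟨ cauchy-schwarz vecs s₁ X ⟩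
  ∑[ u ∈ vecs ] (s₁ u * s₁ u) * ∑[ u ∈ vecs ] (X u * X u)          ≡⟨ cong (_* ∑[ u ∈ vecs ] (X u * X u)) (∑-cong vecs (𝟙-idem ∘ S₁)) ⟩
  A * ∑[ u ∈ vecs ] (X u * X u)                                    ≤⟨ *-monoˡ-≤-nonNeg A {{nonNegative 0≤A}} hits-deviation ⟩
  A * (q * q * q * B)                                              ≡⟨ regroup q A B ⟩
  q ^ 3 * (A * B)                                                  ≡⟨ cong (q ^ 3 *_) ∣S∣≡ ⟨
  q ^ 3 * + ∣ S ∣                                                  ∎
  where
  open ≤-Reasoning
  open Matrices F using (vecs; ∣_∣; _∩_; D)
  open PlaneCounting F using (q; module Lines; module ProductSet)
  open Lines.Hits i≢0 S₂ using (hits; hits-deviation)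
  open ProductSet i≢0 S S₁ S₂ S≡ using (s₁; A; B; ∣S∣≡; deviation-as-sum)
  X : Matrices.Vec2 F → ℤ
  X u = q * hits u - B
  0≤A : 0ℤ ≤ A
  0≤A = ∑-nonneg vecs (0≤𝟙 ∘ S₁)
  square : ∀ x → x ^ 2 ≡ x * x
  square x = cong (x *_) (*-identityʳ x)
  regroup : ∀ q A B → A * (q * q * q * B) ≡ q * (q * (q * 1ℤ)) * (A * B)
  regroup = solve-∀
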